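{- Let $A\subseteq\mathbb F_2^n\setminus\{0\}$ have size $q$, and let $a=\lceil\log(q+1)\rceil$. Then $A$ contains at least \[ \prod_{j=0}^{a-1}(q+1-2^j) \] ordered linearly independent $a$-tuples (i.e., tuples $(v_1,\dots,v_a)\in A^a$ with $v_1,\dots,v_a$ linearly independent over $\mathbb F_2$).
   Context: $\log$ is base $2$. -}

module Defs where

open import Data.Nat using (ℕ; zero; suc; _+_; _*_; _∸_; _^_)
open import Data.Bool using (Bool; true; false; _xor_; _∧_)
open import Relation.Binary.PropositionalEquality using (_≡_)
open import Data.Vec using (Vec; []; _∷_; replicate; zipWith; map)

-- The vector space 𝔽₂ⁿ, with 𝔽₂ = Bool (false = 0, true = 1, xor = +, ∧ = ·).
F2^ : ℕ → Set
F2^ n = Vec Bool n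

zeroV : ∀ {n} → F2^ n
zeroV = replicate _ false

_⊕_ : ∀ {n} → F2^ n → F2^ n → F2^ n
_⊕_ = zipWith _xor_

_·_ : ∀ {n} → Bool → F2^ n → F2^ n
c · v = map (c ∧_) v

linComb : ∀ {n a} → Vec Bool a → Vec (F2^ n) a → F2^ n
linComb []       []       = zeroV
linComb (c ∷ cs) (v ∷ vs) = (c · v) ⊕ linComb cs vs

LinIndep : ∀ {n a} → Vec (F2^ n) a → Set
LinIndep {n} {a} vs = ∀ (c : Vec Bool a) → linComb c vs ≡ zeroV → c ≡ replicate a false

prodTerm : ℕ → ℕ → ℕ
prodTerm q zero    = 1
prodTerm q (suc a) = prodTerm q a * (q + 1 ∸ 2 ^ a)

{-# OPTIONS --safe #-}
module Submission where

-- A linearly independent j-tuple t of vectors of A spans 2 ^ j vectors, one of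
-- which is zeroV ∉ A, so at least |A| + 1 − 2 ^ j vectors of A lie outside
-- span t, and prepending any of them keeps the tuple independent. Extending
-- every independent tuple in all these ways, starting from the empty tuple,
-- yields distinct tuples at every stage, at least ∏_{j<k} (|A| + 1 − 2 ^ j)
-- of them after k stages.

open import Defs
open import Data.Nat using (ℕ; zero; suc; _+_; _*_; _∸_; _^_; _≤_; z≤n; s≤s)
open import Data.Nat.Properties using (≤-trans; ≤-reflexive; +-mono-≤; *-monoˡ-≤; m≤n+o⇒m∸n≤o; +-comm; +-identityʳ; module ≤-Reasoning)
open import Data.Nat.Logarithm using (⌈log₂_⌉)
open import Data.Bool using (Bool; true; false)
import Data.Bool.Properties as Bool
open import Data.Vec using (Vec; []; _∷_; replicate; tail)
import Data.Vec.Properties as Vec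
open import Data.List using (List; []; _∷_; [_]; length; _++_; map; filter; concatMap)
open import Data.List.Properties using (length-++; length-map; length-removeAt′)
open import Data.List.Membership.Propositional using (_∈_; _∉_)
open import Data.List.Membership.Propositional.Properties using (∈-map⁺; ∈-map⁻; ∈-++⁺ˡ; ∈-++⁺ʳ; ∈-filter⁺; ∈-filter⁻)
import Data.List.Membership.DecPropositional as DecMembership
open import Data.List.Relation.Binary.Subset.Propositional using (_⊆_)
open import Data.List.Relation.Unary.All as All using (All; []; _∷_)
import Data.List.Relation.Unary.All.Properties as All
open import Data.List.Relation.Unary.Any as Any using (here; there)
open import Data.List.Relation.Unary.AllPairs as AllPairs using ([]; _∷_)
import Data.List.Relation.Unary.AllPairs.Properties as AllPairs
open import Data.List.Relation.Unary.Unique.Propositional using (Unique)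
import Data.List.Relation.Unary.Unique.Propositional.Properties as Unique
open import Data.Product using (Σ; _×_; _,_)
open import Data.Empty using (⊥)
open import Relation.Nullary using (Dec; ¬?; yes; no; contradiction)
open import Relation.Binary.PropositionalEquality using (_≡_; _≢_; refl; sym; trans; cong; cong₂; subst; ≢-sym; module ≡-Reasoning)
import Data.Vec.Relation.Unary.All as VAll

private
  variable
    X Y : Set
    m n j : ℕ

∈-─⁺ : ∀ {x y : X} {ys} (x∈ys : x ∈ ys) → y ∈ ys → y ≢ x → y ∈ (ys Any.─ x∈ys)
∈-─⁺ (here refl) (here refl) y≢x = contradiction refl y≢x
∈-─⁺ (here _)    (there y∈ys) _  = y∈ys
∈-─⁺ (there _)   (here y≡z)  _   = here y≡z
∈-─⁺ (there x∈ys) (there y∈ys) y≢x = there (∈-─⁺ x∈ys y∈ys y≢x)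

Unique-⊆⇒length≤ : {xs ys : List X} → Unique xs → xs ⊆ ys → length xs ≤ length ys
Unique-⊆⇒length≤ {xs = []} _ _ = z≤n
Unique-⊆⇒length≤ {xs = x ∷ xs} {ys} (x∉xs ∷ xs!) xs⊆ys = begin
  suc (length xs)                  ≤⟨ s≤s (Unique-⊆⇒length≤ xs! xs⊆ys─x) ⟩
  suc (length (ys Any.─ x∈ys))     ≡⟨ sym (length-removeAt′ ys (Any.index x∈ys)) ⟩
  length ys                        ∎
  where
  open ≤-Reasoning
  x∈ys = xs⊆ys (here refl)
  xs⊆ys─x : xs ⊆ (ys Any.─ x∈ys)
  xs⊆ys─x y∈xs = ∈-─⁺ x∈ys (xs⊆ys (there y∈xs)) (≢-sym (All.lookup x∉xs y∈xs))

Unique-concatMap⁺ : {f : X → List Y} (g : Y → X) {xs : List X} → Unique xs →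
                    (∀ x → Unique (f x)) → (∀ {x y} → y ∈ f x → g y ≡ x) →
                    Unique (concatMap f xs)
Unique-concatMap⁺ {f = f} g xs! f! g∘f =
  Unique.concat⁺ (All.map⁺ (All.tabulate λ {x} _ → f! x))
                 (AllPairs.map⁺ (AllPairs.map disjoint xs!))
  where
  disjoint : ∀ {x x′} → x ≢ x′ → ∀ {y} → y ∈ f x × y ∈ f x′ → ⊥
  disjoint x≢x′ (y∈fx , y∈fx′) = x≢x′ (trans (sym (g∘f y∈fx)) (g∘f y∈fx′))

length-concatMap-≥ : (f : X → List Y) (xs : List X) →
                     All (λ x → m ≤ length (f x)) xs → length xs * m ≤ length (concatMap f xs)
length-concatMap-≥ f []       []               = z≤n
length-concatMap-≥ f (x ∷ xs) (m≤fx ∷ m≤fxs) rewrite length-++ (f x) {concatMap f xs} =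
  +-mono-≤ m≤fx (length-concatMap-≥ f xs m≤fxs)

⊕-identityˡ : (w : F2^ n) → zeroV ⊕ w ≡ w
⊕-identityˡ []      = refl
⊕-identityˡ (b ∷ w) = cong (b ∷_) (⊕-identityˡ w)

·-zeroˡ : (v : F2^ n) → false · v ≡ zeroV
·-zeroˡ []      = refl
·-zeroˡ (_ ∷ v) = cong (false ∷_) (·-zeroˡ v)

·-identityˡ : (v : F2^ n) → true · v ≡ v
·-identityˡ []      = refl
·-identityˡ (b ∷ v) = cong (b ∷_) (·-identityˡ v)

⊕≡zeroV⇒≡ : (u w : F2^ n) → u ⊕ w ≡ zeroV → u ≡ w
⊕≡zeroV⇒≡ []          []          _  = refl
⊕≡zeroV⇒≡ (false ∷ u) (false ∷ w) eq = cong (false ∷_) (⊕≡zeroV⇒≡ u w (Vec.∷-injectiveʳ eq))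
⊕≡zeroV⇒≡ (true  ∷ u) (true  ∷ w) eq = cong (true ∷_)  (⊕≡zeroV⇒≡ u w (Vec.∷-injectiveʳ eq))
⊕≡zeroV⇒≡ (false ∷ u) (true  ∷ w) ()
⊕≡zeroV⇒≡ (true  ∷ u) (false ∷ w) ()

linComb-replicate-false : (t : Vec (F2^ n) j) → linComb (replicate j false) t ≡ zeroV
linComb-replicate-false []      = refl
linComb-replicate-false (v ∷ t) = begin
  (false · v) ⊕ linComb (replicate _ false) t  ≡⟨ cong₂ _⊕_ (·-zeroˡ v) (linComb-replicate-false t) ⟩
  zeroV ⊕ zeroV                                ≡⟨ ⊕-identityˡ zeroV ⟩
  zeroV                                        ∎
  where open ≡-Reasoning

coefficients : (j : ℕ) → List (Vec Bool j)
coefficients zero    = [ [] ]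
coefficients (suc j) = map (true ∷_) (coefficients j) ++ map (false ∷_) (coefficients j)

length-coefficients : ∀ j → length (coefficients j) ≡ 2 ^ j
length-coefficients zero    = refl
length-coefficients (suc j) = begin
  length (map (true ∷_) cs ++ map (false ∷_) cs)     ≡⟨ length-++ (map (true ∷_) cs) ⟩
  length (map (true ∷_) cs) + length (map (false ∷_) cs)
    ≡⟨ cong₂ _+_ (length-map (true ∷_) cs) (length-map (false ∷_) cs) ⟩
  length cs + length cs                               ≡⟨ cong (λ k → k + k) (length-coefficients j) ⟩
  2 ^ j + 2 ^ j                                       ≡⟨ cong (2 ^ j +_) (sym (+-identityʳ (2 ^ j))) ⟩
  2 ^ suc j                                           ∎
  where
  open ≡-Reasoning
  cs = coefficients j

∈-coefficients : (c : Vec Bool j) → c ∈ coefficients j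
∈-coefficients []          = here refl
∈-coefficients (true ∷ c)  = ∈-++⁺ˡ (∈-map⁺ (true ∷_) (∈-coefficients c))
∈-coefficients (false ∷ c) = ∈-++⁺ʳ (map (true ∷_) (coefficients _)) (∈-map⁺ (false ∷_) (∈-coefficients c))

span : Vec (F2^ n) j → List (F2^ n)
span {j = j} t = map (λ c → linComb c t) (coefficients j)

length-span : (t : Vec (F2^ n) j) → length (span t) ≡ 2 ^ j
length-span {j = j} t = trans (length-map _ (coefficients j)) (length-coefficients j)

linComb∈span : (c : Vec Bool j) (t : Vec (F2^ n) j) → linComb c t ∈ span t
linComb∈span c t = ∈-map⁺ (λ c → linComb c t) (∈-coefficients c)

zeroV∈span : (t : Vec (F2^ n) j) → zeroV ∈ span t
zeroV∈span {j = j} t = subst (_∈ span t) (linComb-replicate-false t) (linComb∈span (replicate j false) t)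

LinIndep-∷ : {t : Vec (F2^ n) j} {v : F2^ n} → LinIndep t → v ∉ span t → LinIndep (v ∷ t)
LinIndep-∷ {t = t} {v} t-indep _ (false ∷ c) eq = cong (false ∷_) (t-indep c (begin
  linComb c t                ≡⟨ sym (⊕-identityˡ (linComb c t)) ⟩
  zeroV ⊕ linComb c t        ≡⟨ cong (_⊕ linComb c t) (sym (·-zeroˡ v)) ⟩
  (false · v) ⊕ linComb c t  ≡⟨ eq ⟩
  zeroV                      ∎))
  where open ≡-Reasoning
LinIndep-∷ {t = t} {v} _ v∉span (true ∷ c) eq =
  contradiction (subst (_∈ span t) (sym v≡c·t) (linComb∈span c t)) v∉span
  where
  v≡c·t : v ≡ linComb c t
  v≡c·t = ⊕≡zeroV⇒≡ v (linComb c t) (trans (cong (_⊕ linComb c t) (sym (·-identityˡ v))) eq)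

module _ {n : ℕ} (A : List (F2^ n)) where

  open DecMembership (Vec.≡-dec {n = n} Bool._≟_) using (_∈?_)

  ∉span? : (t : Vec (F2^ n) j) (v : F2^ n) → Dec (v ∉ span t)
  ∉span? t v = ¬? (v ∈? span t)

  outside : Vec (F2^ n) j → List (F2^ n)
  outside t = filter (∉span? t) A

  extensions : Vec (F2^ n) j → List (Vec (F2^ n) (suc j))
  extensions t = map (_∷ t) (outside t)

  independentTuples : (k : ℕ) → List (Vec (F2^ n) k)
  independentTuples zero    = [ [] ]
  independentTuples (suc k) = concatMap extensions (independentTuples k)

  IndependentIn : Vec (F2^ n) j → Set
  IndependentIn t = VAll.All (_∈ A) t × LinIndep t

  length-outside : Unique A → All (_≢ zeroV) A → (t : Vec (F2^ n) j) →
                   length A + 1 ∸ 2 ^ j ≤ length (outside t)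
  length-outside {j = j} A! A≢0 t = m≤n+o⇒m∸n≤o (length A + 1) (2 ^ j) (begin
    length A + 1                          ≡⟨ +-comm (length A) 1 ⟩
    length (zeroV ∷ A)                    ≤⟨ Unique-⊆⇒length≤ (All.map ≢-sym A≢0 ∷ A!) covered ⟩
    length (span t ++ outside t)          ≡⟨ length-++ (span t) ⟩
    length (span t) + length (outside t)  ≡⟨ cong (_+ length (outside t)) (length-span t) ⟩
    2 ^ j + length (outside t)            ∎)
    where
    open ≤-Reasoning
    covered : zeroV ∷ A ⊆ span t ++ outside t
    covered (here refl) = ∈-++⁺ˡ (zeroV∈span t)
    covered {v} (there v∈A) with v ∈? span t
    ... | yes v∈span = ∈-++⁺ˡ v∈span
    ... | no  v∉span = ∈-++⁺ʳ (span t) (∈-filter⁺ (∉span? t) v∈A v∉span)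

  length-extensions : Unique A → All (_≢ zeroV) A → (t : Vec (F2^ n) j) →
                      length A + 1 ∸ 2 ^ j ≤ length (extensions t)
  length-extensions A! A≢0 t =
    ≤-trans (length-outside A! A≢0 t) (≤-reflexive (sym (length-map (_∷ t) (outside t))))

  Unique-extensions : Unique A → (t : Vec (F2^ n) j) → Unique (extensions t)
  Unique-extensions A! t = Unique.map⁺ Vec.∷-injectiveˡ (Unique.filter⁺ (∉span? t) A!)

  tail-extensions : {t : Vec (F2^ n) j} {u : Vec (F2^ n) (suc j)} → u ∈ extensions t → tail u ≡ t
  tail-extensions {t = t} u∈ext with ∈-map⁻ (_∷ t) u∈ext
  ... | _ , _ , refl = refl

  extensions-independentIn : {t : Vec (F2^ n) j} → IndependentIn t → All IndependentIn (extensions t)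
  extensions-independentIn {t = t} (t⊆A , t-indep) = All.map⁺ (All.tabulate λ v∈outside →
    let v∈A , v∉span = ∈-filter⁻ (∉span? t) v∈outside
    in  v∈A VAll.∷ t⊆A , LinIndep-∷ t-indep v∉span)

  Unique-independentTuples : Unique A → ∀ k → Unique (independentTuples k)
  Unique-independentTuples A! zero    = [] ∷ []
  Unique-independentTuples A! (suc k) =
    Unique-concatMap⁺ tail (Unique-independentTuples A! k) (Unique-extensions A!) tail-extensions

  independentTuples-independentIn : ∀ k → All IndependentIn (independentTuples k)
  independentTuples-independentIn zero    = (VAll.[] , λ { [] _ → refl }) ∷ []
  independentTuples-independentIn (suc k) =
    All.concat⁺ (All.map⁺ (All.map extensions-independentIn (independentTuples-independentIn k)))

  prodTerm≤length-independentTuples : Unique A → All (_≢ zeroV) A → ∀ k →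
                                      prodTerm (length A) k ≤ length (independentTuples k)
  prodTerm≤length-independentTuples A! A≢0 zero    = s≤s z≤n
  prodTerm≤length-independentTuples A! A≢0 (suc k) = begin
    prodTerm (length A) k * (length A + 1 ∸ 2 ^ k)
      ≤⟨ *-monoˡ-≤ (length A + 1 ∸ 2 ^ k) (prodTerm≤length-independentTuples A! A≢0 k) ⟩
    length (independentTuples k) * (length A + 1 ∸ 2 ^ k)
      ≤⟨ length-concatMap-≥ extensions (independentTuples k) (All.tabulate λ {t} _ → length-extensions A! A≢0 t) ⟩
    length (independentTuples (suc k))
      ∎
    where open ≤-Reasoning

lemma2p1 : (n q : ℕ) (A : List (F2^ n)) → Unique A → length A ≡ q
    → All (λ v → v ≢ zeroV) A
    → Σ (List (Vec (F2^ n) ⌈log₂ (q + 1) ⌉)) λ T →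
        Unique T
        × All (λ t → VAll.All (λ v → v ∈ A) t × LinIndep t) T
        × prodTerm q ⌈log₂ (q + 1) ⌉ ≤ length T
lemma2p1 n .(length A) A A! refl A≢0 =
  independentTuples A k ,
  Unique-independentTuples A A! k ,
  independentTuples-independentIn A k ,
  prodTerm≤length-independentTuples A A! A≢0 k
  where k = ⌈log₂ (length A + 1) ⌉
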